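{- Assume that each $L_i$ ($1\le i\le d$) is prefix-closed (equivalently, $\boldsymbol{L}$ is prefix-closed: for all $\boldsymbol{u},\boldsymbol{v}\in\boldsymbol{A}^*$, $\boldsymbol{u}\boldsymbol{v}\in\boldsymbol{L}$ implies $\boldsymbol{u}\in\boldsymbol{L}$). Let $\mathbb{K}$ be a semiring. A sequence $f\colon\mathbb{N}^d\to\mathbb{K}$ is $(\boldsymbol{\mathcal{S}},\mathbb{K})$-regular if and only if there exists a stable finitely generated $\mathbb{K}$-submodule of $\mathbb{K}^{\mathbb{N}^d}$ containing $f$.
   Context: An abstract numeration system is a triple $\mathcal{S}=(L,A,<)$ where $L$ is an infinite regular language over a finite alphabet $A$ totally ordered by $<$. Words are ordered by the radix order ($u<_{\rm rad}v$ iff $|u|<|v|$, or $|u|=|v|$ and $u$ is lexicographically smaller than $v$); $\mathrm{rep}_{\mathcal{S}}\colon\mathbb{N}\to L$ maps $n$ to the $n$-th word of $L$ (indexing from $0$) and $\mathrm{val}_{\mathcal{S}}$ is its inverse. Fix $d\ge1$, abstract numeration systems $\mathcal{S}_i=(L_i,A_i,<_i)$ for $i\in\{1,\dots,d\}$, $\boldsymbol{\mathcal{S}}=(\mathcal{S}_1,\dots,\mathcal{S}_d)$, and a symbol $\#\notin A_1\cup\dots\cup A_d$. Let $\boldsymbol{\#}=(\#,\dots,\#)$ and $\boldsymbol{A}=\big((A_1\cup\{\#\})\times\cdots\times(A_d\cup\{\#\})\big)\setminus\{\boldsymbol{\#}\}$. For words $w_1,\dots,w_d$, $(w_1,\dots,w_d)^\#$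 denotes the word over $\boldsymbol{A}$ obtained by padding each $w_i$ on the left with $\#$'s up to the maximal length $\ell$ of the $w_i$ and reading the $d$ padded words in parallel. Let $\boldsymbol{L}=\{(w_1,\dots,w_d)^\#: w_i\in L_i\}$, $\mathrm{rep}_{\boldsymbol{\mathcal{S}}}(n_1,\dots,n_d)=(\mathrm{rep}_{\mathcal{S}_1}(n_1),\dots,\mathrm{rep}_{\mathcal{S}_d}(n_d))^\#$ (a bijection $\mathbb{N}^d\to\boldsymbol{L}$) and $\mathrm{val}_{\boldsymbol{\mathcal{S}}}$ its inverse. A formal series $S\colon A^*\to\mathbb{K}$ (with coefficients $(S,w)$) is $\mathbb{K}$-recognizable if there exist $r\ge1$, a monoid morphism $\mu\colon A^*\to\mathbb{K}^{r\times r}$, $\lambda\in\mathbb{K}^{1\times r}$, $\gamma\in\mathbb{K}^{r\times1}$ with $(S,w)=\lambda\mu(w)\gamma$ for all $w$. A sequence $f\colon\mathbb{N}^d\to\mathbb{K}$ is $(\boldsymbol{\mathcal{S}},\mathbb{K})$-regular if the series $S_f=\sum_{\boldsymbol{w}\in\boldsymbol{L}}f(\mathrm{val}_{\boldsymbol{\mathcal{S}}}(\boldsymbol{w}))\,\boldsymbol{w}$ over $\boldsymbol{A}$ is $\mathbb{K}$-recognizable. For $f\colon\mathbb{N}^d\to\mathbb{K}$ and $\boldsymbol{w}\in\boldsymbol{A}^*$, define $f\circ\boldsymbol{w}\colon\mathbb{N}^d\to\mathbb{K}$ by $(f\circ\boldsymbol{w})(\boldsymbol{n})=f(\mathrm{val}_{\boldsymbol{\mathcal{S}}}(\mathrm{rep}_{\boldsymbol{\mathcal{S}}}(\boldsymbol{n})\boldsymbol{w}))$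 if the concatenation $\mathrm{rep}_{\boldsymbol{\mathcal{S}}}(\boldsymbol{n})\boldsymbol{w}$ lies in $\boldsymbol{L}$, and $0$ otherwise. A $\mathbb{K}$-submodule of $\mathbb{K}^{\mathbb{N}^d}$ is stable if it is closed under $f\mapsto f\circ\boldsymbol{w}$ for all $\boldsymbol{w}\in\boldsymbol{A}^*$. -}

module Defs where

open import Level using (Level; _⊔_)
open import Function using (_∘_)
open import Data.Empty using (⊥)
open import Data.Nat using (ℕ; zero; suc; _∸_; _<_) renaming (_⊔_ to _⊔ₙ_)
open import Data.Fin using (Fin; zero; suc) renaming (_<_ to _<ᶠ_)
open import Data.List using (List; []; _∷_; _++_; length; map; replicate; foldl; upTo)
open import Data.List.Relation.Unary.All using (All)
open import Data.List.Relation.Binary.Pointwise using (Pointwise)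
open import Data.Maybe using (Maybe; just; nothing; Is-just)
open import Data.Bool using (Bool; T)
open import Data.Product using (Σ; _×_; _,_)
open import Data.Sum using (_⊎_)
open import Relation.Binary.PropositionalEquality using (_≡_)
open import Relation.Nullary using (¬_)
open import Algebra.Bundles using (Semiring)

LexLt : ∀ {k} → List (Fin k) → List (Fin k) → Set
LexLt [] _ = ⊥
LexLt (_ ∷ _) [] = ⊥
LexLt (a ∷ u) (b ∷ v) = (a <ᶠ b) ⊎ ((a ≡ b) × LexLt u v)

_<rad_ : ∀ {k} → List (Fin k) → List (Fin k) → Set
u <rad v = (length u < length v) ⊎ ((length u ≡ length v) × LexLt u v)

-- L is regular: it is the language of a DFA (states Fin states).
-- rep is the n-th word of L in radix order, specified as the strictly
-- radix-increasing bijection ℕ → L (this forces L to be infinite, and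
-- determines rep uniquely).

record ANS : Set where
  field
    k      : ℕ
    states : ℕ
    δ      : Fin states → Fin k → Fin states
    q₀     : Fin states
    final  : Fin states → Bool

  accepts : List (Fin k) → Set
  accepts w = T (final (foldl δ q₀ w))

  field
    rep      : ℕ → List (Fin k)
    rep-∈    : ∀ n → accepts (rep n)
    rep-onto : ∀ w → accepts w → Σ ℕ (λ n → rep n ≡ w)
    rep-mono : ∀ {m n} → m < n → rep m <rad rep n

PrefixClosed : ANS → Set
PrefixClosed S = ∀ u v → ANS.accepts S (u ++ v) → ANS.accepts S u

-- d-dimensional setting: S : Fin d → ANS.
-- Letters of the bold alphabet: tuples over (A_i ∪ {#}), with # = nothing.
-- A tuple is a letter of bold A iff it is not all-#  (Valid).

Letter : ∀ {d} → (Fin d → ANS) → Set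
Letter S = ∀ i → Maybe (Fin (ANS.k (S i)))

Valid : ∀ {d} (S : Fin d → ANS) → Letter S → Set
Valid {d} S a = Σ (Fin d) (λ i → Is-just (a i))

Word : ∀ {d} → (Fin d → ANS) → Set
Word S = List (Letter S)

_≈ʷ_ : ∀ {d} {S : Fin d → ANS} → Word S → Word S → Set
_≈ʷ_ = Pointwise (λ a b → ∀ i → a i ≡ b i)

maxLen : ∀ {d} → (Fin d → ℕ) → ℕ
maxLen {zero} _ = 0
maxLen {suc d} ℓs = ℓs zero ⊔ₙ maxLen (ℓs ∘ suc)

at : ∀ {X : Set} → List (Maybe X) → ℕ → Maybe X
at [] _ = nothing
at (x ∷ xs) zero = x
at (x ∷ xs) (suc p) = at xs p

pad : ∀ {d} (S : Fin d → ANS) → (∀ i → List (Fin (ANS.k (S i)))) → Word S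
pad S ws = map (λ p i → at (padded i) p) (upTo ℓ)
  where
  ℓ = maxLen (λ i → length (ws i))
  padded : ∀ i → List (Maybe (Fin (ANS.k (S i))))
  padded i = replicate (ℓ ∸ length (ws i)) nothing ++ map just (ws i)

InL : ∀ {d} (S : Fin d → ANS) → Word S → Set
InL S w = Σ (∀ i → List (Fin (ANS.k (S i))))
            (λ ws → (∀ i → ANS.accepts (S i) (ws i)) × (_≈ʷ_ {S = S} (pad S ws) w))

repS : ∀ {d} (S : Fin d → ANS) → (Fin d → ℕ) → Word S
repS S n = pad S (λ i → ANS.rep (S i) (n i))

module _ {c ℓ : Level} (K : Semiring c ℓ) where
  open Semiring K using (Carrier; _≈_; _+_; _*_; 0#; 1#)

  Seq : ℕ → Set c
  Seq d = (Fin d → ℕ) → Carrier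

  sumK : ∀ {r} → (Fin r → Carrier) → Carrier
  sumK {zero} _ = 0#
  sumK {suc r} v = v zero + sumK (v ∘ suc)

  Mat : ℕ → Set c
  Mat r = Fin r → Fin r → Carrier

  idMat : ∀ {r} → Mat r
  idMat zero zero = 1#
  idMat zero (suc j) = 0#
  idMat (suc i) zero = 0#
  idMat (suc i) (suc j) = idMat i j

  mulMat : ∀ {r} → Mat r → Mat r → Mat r
  mulMat M N i j = sumK (λ l → M i l * N l j)

  μ* : ∀ {r} {X : Set} → (X → Mat r) → List X → Mat r
  μ* μ [] = idMat
  μ* μ (a ∷ w) = mulMat (μ a) (μ* μ w)

  bilin : ∀ {r} → (Fin r → Carrier) → Mat r → (Fin r → Carrier) → Carrier
  bilin λv M γ = sumK (λ i → λv i * sumK (λ j → M i j * γ j))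

  -- x is the coefficient (S_f, w) of the series
  -- S_f = Σ_{w ∈ bold L} f(val_S(w)) w, i.e.
  -- x = f(n) when rep_S(n) = w, and x = 0 when w ∉ bold L.
  IsCoeff : ∀ {d} (S : Fin d → ANS) → Seq d → Word S → Carrier → Set ℓ
  IsCoeff S f w x = (∀ n → _≈ʷ_ {S = S} (repS S n) w → x ≈ f n) × (¬ InL S w → x ≈ 0#)

  Regular : ∀ {d} (S : Fin d → ANS) → Seq d → Set (c ⊔ ℓ)
  Regular S f =
    Σ ℕ (λ r →
    Σ (Letter S → Mat (suc r)) (λ μ →
    Σ (Fin (suc r) → Carrier) (λ λv →
    Σ (Fin (suc r) → Carrier) (λ γ →
      ∀ (w : Word S) → All (Valid S) w → IsCoeff S f w (bilin λv (μ* μ w) γ)))))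

  -- h = f ∘ w :  h(n) = f(val_S(rep_S(n) w)) if rep_S(n) w ∈ bold L, else 0
  IsComp : ∀ {d} (S : Fin d → ANS) → Seq d → Word S → Seq d → Set ℓ
  IsComp S f w h = ∀ n → IsCoeff S f (repS S n ++ w) (h n)

  -- h lies in the K-submodule generated by g_0, …, g_{t-1}
  -- (right K-module structure on K^{ℕ^d}: (g·k)(n) = g(n) * k)
  InSpan : ∀ {d t} → (Fin t → Seq d) → Seq d → Set (c ⊔ ℓ)
  InSpan {d} {t} g h =
    Σ (Fin t → Carrier) (λ κ → ∀ n → h n ≈ sumK (λ j → g j n * κ j))

  Stable : ∀ {d t} (S : Fin d → ANS) → (Fin t → Seq d) → Set (c ⊔ ℓ)
  Stable {d} S g =
    ∀ (h : Seq d) → InSpan g h → ∀ (w : Word S) → All (Valid S) w →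
      Σ (Seq d) (λ h′ → InSpan g h′ × IsComp S h w h′)

  InStableFG : ∀ {d} (S : Fin d → ANS) → Seq d → Set (c ⊔ ℓ)
  InStableFG {d} S f =
    Σ ℕ (λ t → Σ (Fin t → Seq d) (λ g → Stable S g × InSpan g f))

module Submission where

-- If S_f = λ μ(·) γ, let q(u) be the state reached on a padded word u by the product of the
-- automata reading its d components. The sequences n ↦ [q(rep n) = c] · (λ μ(rep n))_l span a
-- module containing f, and it is stable: composing with w multiplies the row λ μ(rep n) by μ(w)
-- and moves c to its successor under w, or gives 0 when that successor rejects, i.e. when
-- rep(n) w ∉ L.
-- Conversely, if g_1, …, g_t generate a stable module, the coordinates of g_j ∘ a in terms of
-- the g_l are the columns of a matrix μ(a). By induction on w, the coefficient of rep(n) w in the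
-- series of Σ_j x_j g_j is Σ_l g_l(n) (μ(w) x)_l; here prefix-closedness makes every extension
-- of a word outside L stay outside L. It also gives rep(0) = ε, so λ = (g_l(0))_l together with
-- the coordinates γ of f represent S_f.

open import Defs
open import Level using (Level)
open import Data.Nat using (ℕ; _≤_)
open import Data.Fin using (Fin)
open import Function.Bundles using (_⇔_)
open import Algebra.Bundles using (Semiring)

open import Function using (_∘_)
open import Function.Bundles using (mk⇔)
open import Data.Empty using (⊥-elim)
open import Data.Unit using (⊤; tt)
open import Data.Nat using (zero; suc; _∸_; _<_; z≤n; s≤s)
  renaming (_+_ to _+ℕ_; _*_ to _*ℕ_; _⊔_ to _⊔ℕ_)
open import Data.Nat.Properties
  using (≤-trans; ≤-reflexive; ≤-antisym; m≤m⊔n; m≤n⊔m; ⊔-lub; ⊔-sel; ⊔-identityʳ; n≤0⇒n≡0; m∸n+n≡m; m+n∸n≡m; m≤n+m; n∸n≡0; suc-injective)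
open import Data.Fin using (zero; suc; _↑ˡ_; _↑ʳ_; combine; remQuot)
open import Data.Fin.Properties using (remQuot-combine; all?; any?)
open import Data.List using (List; []; _∷_; _++_; length; map; replicate; foldl; upTo; applyUpTo)
open import Data.List.Properties
  using (map-++; map-∘; map-upTo; length-map; length-++; length-replicate; length-upTo; ∷-injective; foldl-++; ++-assoc; ++-identityʳ)
open import Data.List.Relation.Unary.All using (All; []; _∷_)
open import Data.List.Relation.Unary.All.Properties using (map⁺; applyUpTo⁺₁; ++⁺)
open import Data.List.Relation.Binary.Pointwise as PW using ([]; _∷_)
open import Data.Maybe using (Maybe; just; nothing; Is-just)
open import Data.Maybe.Relation.Unary.Any as Any using ()
open import Data.Bool using (Bool; false; T)
open import Data.Product using (∃; ∃₂; _×_; _,_; proj₁; proj₂)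
open import Data.Sum using (_⊎_; inj₁; inj₂)
open import Relation.Binary.Core using (Rel)
open import Relation.Binary.Structures using (IsEquivalence)
open import Relation.Binary.PropositionalEquality as ≡ using (_≡_; cong; cong₂; subst; module ≡-Reasoning)
open import Relation.Nullary using (¬_; yes; no)
open import Relation.Nullary.Decidable using (T?)
open import Relation.Unary using (Decidable)

module LinearAlgebra {c ℓ : Level} (K : Semiring c ℓ) where
  open Semiring K hiding (zero)
  open import Algebra.Properties.Semiring.Sum K using (sum; sum-cong-≋; sum-cong-≗; sum-replicate-zero; ∑-comm; *-distribˡ-sum; *-distribʳ-sum)
  open import Relation.Binary.Reasoning.Setoid setoid

  ∑ : ∀ {n} → (Fin n → Carrier) → Carrier
  ∑ = sumK K

  ∑≡sum : ∀ {n} (u : Fin n → Carrier) → ∑ u ≡ sum u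
  ∑≡sum {zero} u = ≡.refl
  ∑≡sum {suc n} u = cong (u zero +_) (∑≡sum (u ∘ suc))

  ∑-cong : ∀ {n} {u v : Fin n → Carrier} → (∀ i → u i ≈ v i) → ∑ u ≈ ∑ v
  ∑-cong {u = u} {v} u≈v = begin
    ∑ u   ≡⟨ ∑≡sum u ⟩
    sum u ≈⟨ sum-cong-≋ u≈v ⟩
    sum v ≡⟨ ∑≡sum v ⟨
    ∑ v   ∎

  ∑-zero : ∀ {n} {u : Fin n → Carrier} → (∀ i → u i ≈ 0#) → ∑ u ≈ 0#
  ∑-zero {n} u≈0 =
    trans (∑-cong u≈0) (trans (reflexive (∑≡sum {n} (λ _ → 0#))) (sum-replicate-zero n))

  ∑-swap : ∀ {m n} (u : Fin m → Fin n → Carrier) →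
           ∑ (λ i → ∑ (λ j → u i j)) ≈ ∑ (λ j → ∑ (λ i → u i j))
  ∑-swap u = begin
    ∑ (λ i → ∑ (λ j → u i j))     ≡⟨ ∑∑≡sumsum u ⟩
    sum (λ i → sum (λ j → u i j)) ≈⟨ ∑-comm u ⟩
    sum (λ j → sum (λ i → u i j)) ≡⟨ ∑∑≡sumsum (λ j i → u i j) ⟨
    ∑ (λ j → ∑ (λ i → u i j))     ∎
    where
    ∑∑≡sumsum : ∀ {m n} (v : Fin m → Fin n → Carrier) →
                ∑ (λ i → ∑ (v i)) ≡ sum (λ i → sum (v i))
    ∑∑≡sumsum {m} v = ≡.trans (∑≡sum {m} _) (sum-cong-≗ (λ i → ∑≡sum (v i)))

  *-distribˡ-∑ : ∀ {n} x (u : Fin n → Carrier) → x * ∑ u ≈ ∑ (λ i → x * u i)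
  *-distribˡ-∑ x u = begin
    x * ∑ u                 ≡⟨ cong (x *_) (∑≡sum u) ⟩
    x * sum u               ≈⟨ *-distribˡ-sum x u ⟩
    sum (λ i → x * u i)     ≡⟨ ∑≡sum (λ i → x * u i) ⟨
    ∑ (λ i → x * u i)       ∎

  *-distribʳ-∑ : ∀ {n} x (u : Fin n → Carrier) → ∑ u * x ≈ ∑ (λ i → u i * x)
  *-distribʳ-∑ x u = begin
    ∑ u * x                 ≡⟨ cong (_* x) (∑≡sum u) ⟩
    sum u * x               ≈⟨ *-distribʳ-sum x u ⟩
    sum (λ i → u i * x)     ≡⟨ ∑≡sum (λ i → u i * x) ⟨
    ∑ (λ i → u i * x)       ∎

  ∑-splitAt : ∀ m {n} (u : Fin (m +ℕ n) → Carrier) →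
              ∑ u ≈ ∑ (λ i → u (i ↑ˡ n)) + ∑ (λ j → u (m ↑ʳ j))
  ∑-splitAt zero u = sym (+-identityˡ _)
  ∑-splitAt (suc m) u = trans (+-congˡ (∑-splitAt m (u ∘ suc))) (sym (+-assoc _ _ _))

  ∑-combine : ∀ m {n} (u : Fin (m *ℕ n) → Carrier) →
              ∑ u ≈ ∑ (λ i → ∑ (λ j → u (combine {m} {n} i j)))
  ∑-combine zero u = refl
  ∑-combine (suc m) {n} u =
    trans (∑-splitAt n u) (+-congˡ (∑-combine m (λ k → u (n ↑ʳ k))))

  ∑-idMatˡ : ∀ {n} (i : Fin n) (u : Fin n → Carrier) → ∑ (λ l → idMat K i l * u l) ≈ u i
  ∑-idMatˡ zero u = begin
    1# * u zero + ∑ (λ l → 0# * u (suc l)) ≈⟨ +-cong (*-identityˡ _) (∑-zero {u = λ l → 0# * u (suc l)} (λ l → zeroˡ _)) ⟩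
    u zero + 0#                            ≈⟨ +-identityʳ _ ⟩
    u zero                                 ∎
  ∑-idMatˡ (suc i) u = begin
    0# * u zero + ∑ (λ l → idMat K i l * u (suc l)) ≈⟨ +-cong (zeroˡ _) (∑-idMatˡ i (u ∘ suc)) ⟩
    0# + u (suc i)                                  ≈⟨ +-identityˡ _ ⟩
    u (suc i)                                       ∎

  ∑-idMatʳ : ∀ {n} (j : Fin n) (u : Fin n → Carrier) → ∑ (λ l → u l * idMat K l j) ≈ u j
  ∑-idMatʳ zero u = begin
    u zero * 1# + ∑ (λ l → u (suc l) * 0#) ≈⟨ +-cong (*-identityʳ _) (∑-zero {u = λ l → u (suc l) * 0#} (λ l → zeroʳ _)) ⟩
    u zero + 0#                            ≈⟨ +-identityʳ _ ⟩
    u zero                                 ∎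
  ∑-idMatʳ (suc j) u = begin
    u zero * 0# + ∑ (λ l → u (suc l) * idMat K l j) ≈⟨ +-cong (zeroʳ _) (∑-idMatʳ j (u ∘ suc)) ⟩
    0# + u (suc j)                                  ≈⟨ +-identityˡ _ ⟩
    u (suc j)                                       ∎

  dot : ∀ {n} → (Fin n → Carrier) → (Fin n → Carrier) → Carrier
  dot u v = ∑ (λ i → u i * v i)

  dot-congˡ : ∀ {n} {u u′ : Fin n → Carrier} (v : Fin n → Carrier) → (∀ i → u i ≈ u′ i) → dot u v ≈ dot u′ v
  dot-congˡ v u≈u′ = ∑-cong (λ i → *-congʳ (u≈u′ i))

  dot-congʳ : ∀ {n} (u : Fin n → Carrier) {v v′ : Fin n → Carrier} → (∀ i → v i ≈ v′ i) → dot u v ≈ dot u v′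
  dot-congʳ u v≈v′ = ∑-cong (λ i → *-congˡ (v≈v′ i))

  matVec : ∀ {m n} → (Fin m → Fin n → Carrier) → (Fin n → Carrier) → Fin m → Carrier
  matVec A v i = dot (A i) v

  vecMat : ∀ {m n} → (Fin m → Carrier) → (Fin m → Fin n → Carrier) → Fin n → Carrier
  vecMat u A k = ∑ (λ i → u i * A i k)

  dot-matVec : ∀ {m n} (u : Fin m → Carrier) (A : Fin m → Fin n → Carrier) (v : Fin n → Carrier) →
               dot u (matVec A v) ≈ dot (vecMat u A) v
  dot-matVec u A v = begin
    ∑ (λ i → u i * ∑ (λ k → A i k * v k))   ≈⟨ ∑-cong (λ i → *-distribˡ-∑ (u i) (λ k → A i k * v k)) ⟩
    ∑ (λ i → ∑ (λ k → u i * (A i k * v k))) ≈⟨ ∑-cong (λ i → ∑-cong (λ k → sym (*-assoc (u i) (A i k) (v k)))) ⟩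
    ∑ (λ i → ∑ (λ k → (u i * A i k) * v k)) ≈⟨ ∑-swap (λ i k → (u i * A i k) * v k) ⟩
    ∑ (λ k → ∑ (λ i → (u i * A i k) * v k)) ≈⟨ ∑-cong (λ k → sym (*-distribʳ-∑ (v k) (λ i → u i * A i k))) ⟩
    ∑ (λ k → ∑ (λ i → u i * A i k) * v k)   ∎

  mulMat-identityˡ : ∀ {r} (M : Mat K r) i j → mulMat K (idMat K) M i j ≈ M i j
  mulMat-identityˡ M i j = ∑-idMatˡ i (λ l → M l j)

  mulMat-assoc : ∀ {r} (A B C : Mat K r) i j →
                 mulMat K (mulMat K A B) C i j ≈ mulMat K A (mulMat K B C) i j
  mulMat-assoc A B C i j = sym (dot-matVec (A i) B (λ l → C l j))

  μ*-++ : ∀ {r} {X : Set} (μ : X → Mat K r) (u w : List X) i j →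
          μ* K μ (u ++ w) i j ≈ mulMat K (μ* K μ u) (μ* K μ w) i j
  μ*-++ μ [] w i j = sym (mulMat-identityˡ (μ* K μ w) i j)
  μ*-++ μ (a ∷ u) w i j = begin
    mulMat K (μ a) (μ* K μ (u ++ w)) i j                    ≈⟨ ∑-cong (λ l → *-congˡ (μ*-++ μ u w l j)) ⟩
    mulMat K (μ a) (mulMat K (μ* K μ u) (μ* K μ w)) i j     ≈⟨ mulMat-assoc (μ a) (μ* K μ u) (μ* K μ w) i j ⟨
    mulMat K (mulMat K (μ a) (μ* K μ u)) (μ* K μ w) i j     ∎

  matVec-identity : ∀ {r} (v : Fin r → Carrier) i → matVec (idMat K) v i ≈ v i
  matVec-identity v i = ∑-idMatˡ i v

  matVec-mulMat : ∀ {r} (A B : Mat K r) v i → matVec (mulMat K A B) v i ≈ matVec A (matVec B v) i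
  matVec-mulMat A B v i = sym (dot-matVec (A i) B v)

maxLen-upper : ∀ {d} (ℓs : Fin d → ℕ) i → ℓs i ≤ maxLen ℓs
maxLen-upper ℓs zero = m≤m⊔n _ _
maxLen-upper ℓs (suc i) = ≤-trans (maxLen-upper (ℓs ∘ suc) i) (m≤n⊔m (ℓs zero) _)

maxLen-least : ∀ {d} (ℓs : Fin d → ℕ) {b} → (∀ i → ℓs i ≤ b) → maxLen ℓs ≤ b
maxLen-least {zero} ℓs _ = z≤n
maxLen-least {suc d} ℓs ℓs≤b = ⊔-lub (ℓs≤b zero) (maxLen-least (ℓs ∘ suc) (ℓs≤b ∘ suc))

maxLen-cong : ∀ {d} {ℓs ℓs′ : Fin d → ℕ} → (∀ i → ℓs i ≡ ℓs′ i) → maxLen ℓs ≡ maxLen ℓs′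
maxLen-cong {zero} _ = ≡.refl
maxLen-cong {suc d} eq = cong₂ _⊔ℕ_ (eq zero) (maxLen-cong (eq ∘ suc))

maxLen-attained : ∀ {d} → Fin d → (ℓs : Fin d → ℕ) → ∃ λ i → ℓs i ≡ maxLen ℓs
maxLen-attained {suc zero} _ ℓs = zero , ≡.sym (⊔-identityʳ (ℓs zero))
maxLen-attained {suc (suc d)} _ ℓs =
  pick (⊔-sel (ℓs zero) (maxLen (ℓs ∘ suc))) (maxLen-attained zero (ℓs ∘ suc))
  where
  pick : ℓs zero ⊔ℕ maxLen (ℓs ∘ suc) ≡ ℓs zero ⊎ ℓs zero ⊔ℕ maxLen (ℓs ∘ suc) ≡ maxLen (ℓs ∘ suc) →
         ∃ (λ i → ℓs (suc i) ≡ maxLen (ℓs ∘ suc)) → ∃ λ i → ℓs i ≡ maxLen ℓs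
  pick (inj₁ eq) _ = zero , ≡.sym eq
  pick (inj₂ eq) (i , eqᵢ) = suc i , ≡.trans eqᵢ (≡.sym eq)

Tuple : ∀ {d} → (Fin d → Set) → Set
Tuple {zero} F = ⊤
Tuple {suc d} F = F zero × Tuple (F ∘ suc)

toTuple : ∀ {d} {F : Fin d → Set} → ((i : Fin d) → F i) → Tuple F
toTuple {zero} a = tt
toTuple {suc d} a = a zero , toTuple (a ∘ suc)

fromTuple : ∀ {d} {F : Fin d → Set} → Tuple F → (i : Fin d) → F i
fromTuple (x , xs) zero = x
fromTuple (x , xs) (suc i) = fromTuple xs i

toTuple-cong : ∀ {d} {F : Fin d → Set} {a b : (i : Fin d) → F i} →
               (∀ i → a i ≡ b i) → toTuple a ≡ toTuple b
toTuple-cong {zero} _ = ≡.refl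
toTuple-cong {suc d} eq = cong₂ _,_ (eq zero) (toTuple-cong (eq ∘ suc))

fromTuple-toTuple : ∀ {d} {F : Fin d → Set} (a : (i : Fin d) → F i) i → fromTuple (toTuple a) i ≡ a i
fromTuple-toTuple a zero = ≡.refl
fromTuple-toTuple a (suc i) = fromTuple-toTuple (a ∘ suc) i

∏ : ∀ {d} → (Fin d → ℕ) → ℕ
∏ {zero} _ = 1
∏ {suc d} sz = sz zero *ℕ ∏ (sz ∘ suc)

encode : ∀ {d} {sz : Fin d → ℕ} → ((i : Fin d) → Fin (sz i)) → Fin (∏ sz)
encode {zero} v = zero
encode {suc d} v = combine (v zero) (encode (v ∘ suc))

decode : ∀ {d} {sz : Fin d → ℕ} → Fin (∏ sz) → (i : Fin d) → Fin (sz i)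
decode {suc d} {sz} c zero = proj₁ (remQuot {sz zero} (∏ (sz ∘ suc)) c)
decode {suc d} {sz} c (suc i) = decode (proj₂ (remQuot {sz zero} (∏ (sz ∘ suc)) c)) i

decode-encode : ∀ {d} {sz : Fin d → ℕ} (v : (i : Fin d) → Fin (sz i)) i → decode {sz = sz} (encode v) i ≡ v i
decode-encode {suc d} {sz} v zero = cong proj₁ (remQuot-combine {sz zero} (v zero) (encode (v ∘ suc)))
decode-encode {suc d} {sz} v (suc i) = ≡.trans
  (cong (λ c → decode c i) (cong proj₂ (remQuot-combine {sz zero} (v zero) (encode (v ∘ suc)))))
  (decode-encode (v ∘ suc) i)

encode-cong : ∀ {d} {sz : Fin d → ℕ} {v v′ : (i : Fin d) → Fin (sz i)} →
              (∀ i → v i ≡ v′ i) → encode {sz = sz} v ≡ encode v′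
encode-cong {zero} _ = ≡.refl
encode-cong {suc d} eq = cong₂ combine (eq zero) (encode-cong (eq ∘ suc))

pattern dead = zero
pattern waiting = suc zero
pattern reading q = suc (suc q)

module ColumnAutomaton (A : ANS) where
  open ANS A

  Column : Set
  Column = List (Maybe (Fin k))

  State : Set
  State = Fin (suc (suc states))

  step : State → Maybe (Fin k) → State
  step dead _ = dead
  step waiting nothing = waiting
  step waiting (just a) = reading (δ q₀ a)
  step (reading q) nothing = dead
  step (reading q) (just a) = reading (δ q a)

  run : State → Column → State
  run = foldl step

  accepting : State → Bool
  accepting dead = false
  accepting waiting = final q₀
  accepting (reading q) = final q

  underlying : State → Fin states
  underlying dead = q₀   -- junk: run-reaches reports dead runs separately
  underlying waiting = q₀
  underlying (reading q) = q

  Accepts : Column → Set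
  Accepts c = T (accepting (run waiting c))

  run-dead : ∀ c → run dead c ≡ dead
  run-dead [] = ≡.refl
  run-dead (_ ∷ c) = run-dead c

  run-reading : ∀ q x → run (reading q) (map just x) ≡ reading (foldl δ q x)
  run-reading q [] = ≡.refl
  run-reading q (a ∷ x) = run-reading (δ q a) x

  run-waiting : ∀ m c → run waiting (replicate m nothing ++ c) ≡ run waiting c
  run-waiting zero c = ≡.refl
  run-waiting (suc m) c = run-waiting m c

  accepting-padded : ∀ m x → accepting (run waiting (replicate m nothing ++ map just x)) ≡ final (foldl δ q₀ x)
  accepting-padded m x rewrite run-waiting m (map just x) with x
  ... | [] = ≡.refl
  ... | a ∷ y rewrite run-reading (δ q₀ a) y = ≡.refl

  reading-accepts : ∀ q c → T (accepting (run (reading q) c)) →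
                    ∃ λ x → c ≡ map just x × T (final (foldl δ q x))
  reading-accepts q [] acc = [] , ≡.refl , acc
  reading-accepts q (nothing ∷ c) acc rewrite run-dead c = ⊥-elim acc
  reading-accepts q (just a ∷ c) acc with reading-accepts (δ q a) c acc
  ... | x , ≡.refl , fin = a ∷ x , ≡.refl , fin

  Accepts⇒padded : ∀ c → Accepts c → ∃₂ λ m x → c ≡ replicate m nothing ++ map just x × accepts x
  Accepts⇒padded [] acc = 0 , [] , ≡.refl , acc
  Accepts⇒padded (nothing ∷ c) acc with Accepts⇒padded c acc
  ... | m , x , ≡.refl , fin = suc m , x , ≡.refl , fin
  Accepts⇒padded (just a ∷ c) acc with reading-accepts (δ q₀ a) c acc
  ... | x , ≡.refl , fin = 0 , a ∷ x , ≡.refl , fin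

  run-reaches : ∀ s c → run s c ≡ dead ⊎ ∃ λ y → underlying (run s c) ≡ foldl δ (underlying s) y
  run-reaches dead c = inj₁ (run-dead c)
  run-reaches waiting [] = inj₂ ([] , ≡.refl)
  run-reaches waiting (nothing ∷ c) = run-reaches waiting c
  run-reaches (reading q) [] = inj₂ ([] , ≡.refl)
  run-reaches (reading q) (nothing ∷ c) = inj₁ (run-dead c)
  run-reaches waiting (just a ∷ c) with run-reaches (reading (δ q₀ a)) c
  ... | inj₁ eq = inj₁ eq
  ... | inj₂ (y , eq) = inj₂ (a ∷ y , eq)
  run-reaches (reading q) (just a ∷ c) with run-reaches (reading (δ q a)) c
  ... | inj₁ eq = inj₁ eq
  ... | inj₂ (y , eq) = inj₂ (a ∷ y , eq)

  accepting⇒final : ∀ s → T (accepting s) → T (final (underlying s))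
  accepting⇒final waiting acc = acc
  accepting⇒final (reading q) acc = acc

  final⇒accepting : ∀ s c → T (accepting (run s c)) → T (final (underlying s)) → T (accepting s)
  final⇒accepting dead c acc _ rewrite run-dead c = ⊥-elim acc
  final⇒accepting waiting c _ fin = fin
  final⇒accepting (reading q) c _ fin = fin

  Accepts-prefix : PrefixClosed A → ∀ c c′ → Accepts (c ++ c′) → Accepts c
  Accepts-prefix prefix-closed c c′ acc
    rewrite foldl-++ step waiting c c′ with run-reaches waiting c
  ... | inj₁ c-dead rewrite c-dead | run-dead c′ = ⊥-elim acc
  ... | inj₂ (x , eqₓ) with run-reaches (run waiting c) c′
  ...   | inj₁ c′-dead rewrite c′-dead = ⊥-elim acc
  ...   | inj₂ (y , eqᵧ) = final⇒accepting (run waiting c) c′ acc (subst (T ∘ final) (≡.sym eqₓ) x-accepted)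
    where
    xy-accepted : accepts (x ++ y)
    xy-accepted = subst (T ∘ final) (≡.trans (≡.trans eqᵧ (cong (λ q → foldl δ q y) eqₓ)) (≡.sym (foldl-++ δ q₀ x y)))
                        (accepting⇒final (run (run waiting c) c′) acc)
    x-accepted : accepts x
    x-accepted = prefix-closed x y xy-accepted

length-padding : ∀ {X : Set} m (x : List X) → length (replicate m nothing ++ map just x) ≡ m +ℕ length x
length-padding m x = ≡.trans (length-++ (replicate m nothing)) (cong₂ _+ℕ_ (length-replicate m) (length-map just x))

applyUpTo-at : ∀ {X : Set} (xs : List (Maybe X)) {n} → length xs ≡ n → applyUpTo (at xs) n ≡ xs
applyUpTo-at [] {zero} _ = ≡.refl
applyUpTo-at (x ∷ xs) {suc n} eq = cong (x ∷_) (applyUpTo-at xs (suc-injective eq))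

rep-zero : (A : ANS) → PrefixClosed A → ANS.rep A 0 ≡ []
rep-zero A prefix-closed with rep-onto [] (prefix-closed [] (rep 0) (rep-∈ 0))
  where open ANS A
... | zero , eq = eq
... | suc m , eq = ⊥-elim (¬<rad-[] (subst (ANS.rep A 0 <rad_) eq (ANS.rep-mono A (s≤s z≤n))))
  where
  ¬<rad-[] : ∀ {k} {u : List (Fin k)} → ¬ u <rad []
  ¬<rad-[] (inj₁ ())
  ¬<rad-[] {u = []} (inj₂ (_ , ()))
  ¬<rad-[] {u = _ ∷ _} (inj₂ (_ , ()))

module BoldWords {d} (S : Fin d → ANS) where
  module CA (i : Fin d) = ColumnAutomaton (S i)

  Components : Set
  Components = (i : Fin d) → List (Fin (ANS.k (S i)))

  _≋_ : Rel (Word S) _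
  _≋_ = _≈ʷ_ {S = S}

  ≋-isEquivalence : IsEquivalence _≋_
  ≋-isEquivalence = PW.isEquivalence (record
    { refl = λ _ → ≡.refl ; sym = λ a≗b i → ≡.sym (a≗b i) ; trans = λ a≗b b≗c i → ≡.trans (a≗b i) (b≗c i) })

  open IsEquivalence ≋-isEquivalence public
    using () renaming (refl to ≋-refl; sym to ≋-sym; trans to ≋-trans; reflexive to ≋-reflexive)

  ≋-++ : ∀ {u u′ v v′} → u ≋ u′ → v ≋ v′ → (u ++ v) ≋ (u′ ++ v′)
  ≋-++ = PW.++⁺

  column : (i : Fin d) → Word S → CA.Column i
  column i = map (λ a → a i)

  column-≋ : ∀ i {u v} → u ≋ v → column i u ≡ column i v
  column-≋ i u≋v = PW.Pointwise-≡⇒≡ (PW.map⁺ _ _ (PW.map (λ a≗b → a≗b i) u≋v))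

  columns-≋ : Fin d → ∀ u v → (∀ i → column i u ≡ column i v) → u ≋ v
  columns-≋ i₀ [] [] _ = []
  columns-≋ i₀ [] (_ ∷ _) eq with eq i₀
  ... | ()
  columns-≋ i₀ (_ ∷ _) [] eq with eq i₀
  ... | ()
  columns-≋ i₀ (a ∷ u) (b ∷ v) eq =
    (λ i → proj₁ (∷-injective (eq i))) ∷ columns-≋ i₀ u v (λ i → proj₂ (∷-injective (eq i)))

  Valid? : Decidable (Valid S)
  Valid? a = any? (λ i → Any.dec (λ _ → yes tt) (a i))

  width : Components → ℕ
  width ws = maxLen (λ i → length (ws i))

  padded : (ws : Components) (i : Fin d) → CA.Column i
  padded ws i = replicate (width ws ∸ length (ws i)) nothing ++ map just (ws i)

  length-padded : ∀ ws i → length (padded ws i) ≡ width ws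
  length-padded ws i = ≡.trans (length-padding (width ws ∸ length (ws i)) (ws i))
                               (m∸n+n≡m (maxLen-upper (λ j → length (ws j)) i))

  column-pad : ∀ ws i → column i (pad S ws) ≡ padded ws i
  column-pad ws i = begin
    column i (pad S ws)                           ≡⟨ map-∘ (upTo (width ws)) ⟨
    map (λ p → at (padded ws i) p) (upTo (width ws)) ≡⟨ map-upTo (at (padded ws i)) (width ws) ⟩
    applyUpTo (at (padded ws i)) (width ws)       ≡⟨ applyUpTo-at (padded ws i) (length-padded ws i) ⟩
    padded ws i                                   ∎
    where open ≡-Reasoning

  length-pad : ∀ ws → length (pad S ws) ≡ width ws
  length-pad ws = ≡.trans (length-map _ (upTo (width ws))) (length-upTo (width ws))

  pad-[] : ∀ ws → (∀ i → ws i ≡ []) → pad S ws ≡ []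
  pad-[] ws ws≡[] = length≡0 (pad S ws) (≡.trans (length-pad ws)
    (n≤0⇒n≡0 (maxLen-least (λ i → length (ws i)) (λ i → ≤-reflexive (cong length (ws≡[] i))))))
    where
    length≡0 : ∀ {X : Set} (xs : List X) → length xs ≡ 0 → xs ≡ []
    length≡0 [] _ = ≡.refl

  pad-cong : Fin d → ∀ {ws vs} → (∀ i → ws i ≡ vs i) → pad S ws ≋ pad S vs
  pad-cong i₀ {ws} {vs} ws≡vs = columns-≋ i₀ (pad S ws) (pad S vs) λ i → begin
    column i (pad S ws) ≡⟨ column-pad ws i ⟩
    padded ws i         ≡⟨ cong₂ (λ ℓ w → replicate (ℓ ∸ length w) nothing ++ map just w)
                                 (maxLen-cong (λ j → cong length (ws≡vs j))) (ws≡vs i) ⟩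
    padded vs i         ≡⟨ column-pad vs i ⟨
    column i (pad S vs) ∎
    where open ≡-Reasoning

  pad-valid : Fin d → ∀ ws → All (Valid S) (pad S ws)
  pad-valid i₀ ws = map⁺ (applyUpTo⁺₁ (λ p → p) (width ws) letter-valid)
    where
    longest : ∃ λ j → length (ws j) ≡ width ws
    longest = maxLen-attained i₀ (λ i → length (ws i))
    at-just : ∀ {X : Set} (xs : List X) {p} → p < length xs → Is-just (at (map just xs) p)
    at-just (_ ∷ _) {zero} _ = Any.just tt
    at-just (_ ∷ xs) {suc p} (s≤s p<) = at-just xs p<
    letter-valid : ∀ {p} → p < width ws → Valid S (λ i → at (padded ws i) p)
    letter-valid {p} p< with longest
    ... | j , eq = j , subst (λ m → Is-just (at (replicate m nothing ++ map just (ws j)) p))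
                             (≡.sym (≡.trans (cong (width ws ∸_) eq) (n∸n≡0 (width ws))))
                             (at-just (ws j) (subst (p <_) (≡.sym eq) p<))

  InL-resp-≋ : ∀ {u v} → InL S u → u ≋ v → InL S v
  InL-resp-≋ (ws , accepted , pad≋u) u≋v = ws , accepted , ≋-trans pad≋u u≋v

  repS∈L : ∀ n → InL S (repS S n)
  repS∈L n = (λ i → ANS.rep (S i) (n i)) , (λ i → ANS.rep-∈ (S i) (n i)) , ≋-refl

  repS-valid : Fin d → ∀ n → All (Valid S) (repS S n)
  repS-valid i₀ n = pad-valid i₀ (λ i → ANS.rep (S i) (n i))

  InL⇒repS : Fin d → ∀ {u} → InL S u → ∃ λ m → repS S m ≋ u
  InL⇒repS i₀ (ws , accepted , pad≋u) =
    (λ i → proj₁ (onto i)) , ≋-trans (pad-cong i₀ (λ i → proj₂ (onto i))) pad≋u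
    where
    onto : ∀ i → ∃ λ n → ANS.rep (S i) n ≡ ws i
    onto i = ANS.rep-onto (S i) (ws i) (accepted i)

  States : Set
  States = (i : Fin d) → CA.State i

  states : Word S → States
  states u i = CA.run i waiting (column i u)

  Accepting : States → Set
  Accepting s = ∀ i → T (CA.accepting i (s i))

  Accepting-resp : ∀ {s s′} → (∀ i → s i ≡ s′ i) → Accepting s → Accepting s′
  Accepting-resp s≡s′ accepting i = subst (λ q → T (CA.accepting i q)) (s≡s′ i) (accepting i)

  Accepting? : Decidable Accepting
  Accepting? s = all? (λ i → T? (CA.accepting i (s i)))

  Accepted : Word S → Set
  Accepted u = Accepting (states u)

  InL⇒Accepted : ∀ {u} → InL S u → Accepted u
  InL⇒Accepted (ws , accepted , pad≋u) i =
    subst (λ c → CA.Accepts i c) (≡.trans (≡.sym (column-pad ws i)) (column-≋ i pad≋u))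
      (subst T (≡.sym (CA.accepting-padded i (width ws ∸ length (ws i)) (ws i))) (accepted i))

  length-column : ∀ i u → length (column i u) ≡ length u
  length-column i u = length-map (λ a → a i) u

  valid⇒length≤width : ∀ {u} → All (Valid S) u → (m : Fin d → ℕ) (ws : Components) →
                       (∀ i → column i u ≡ replicate (m i) nothing ++ map just (ws i)) → length u ≤ width ws
  valid⇒length≤width [] _ _ _ = z≤n
  valid⇒length≤width {a ∷ u} ((i , just-aᵢ) ∷ _) m ws eq with m i | eq i
  ... | zero | eqᵢ = subst (_≤ width ws) length-wsᵢ (maxLen-upper (λ j → length (ws j)) i)
    where
    length-wsᵢ : length (ws i) ≡ length (a ∷ u)
    length-wsᵢ = ≡.trans (≡.sym (length-map just (ws i))) (≡.trans (cong length (≡.sym eqᵢ)) (length-column i (a ∷ u)))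
  ... | suc _ | eqᵢ with a i | just-aᵢ | proj₁ (∷-injective eqᵢ)
  ...   | just _ | _ | ()

  Accepted⇒InL : Fin d → ∀ {u} → All (Valid S) u → Accepted u → InL S u
  Accepted⇒InL i₀ {u} valid acc = ws , accepted , ≋-sym (columns-≋ i₀ u (pad S ws) (λ i → ≡.sym (column-pad≡ i)))
    where
    decomposition : ∀ i → ∃₂ λ m x → column i u ≡ replicate m nothing ++ map just x × ANS.accepts (S i) x
    decomposition i = CA.Accepts⇒padded i (column i u) (acc i)
    m : Fin d → ℕ
    m i = proj₁ (decomposition i)
    ws : Components
    ws i = proj₁ (proj₂ (decomposition i))
    column≡ : ∀ i → column i u ≡ replicate (m i) nothing ++ map just (ws i)
    column≡ i = proj₁ (proj₂ (proj₂ (decomposition i)))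
    accepted : ∀ i → ANS.accepts (S i) (ws i)
    accepted i = proj₂ (proj₂ (proj₂ (decomposition i)))
    length-u : ∀ i → length u ≡ m i +ℕ length (ws i)
    length-u i = ≡.trans (≡.sym (length-column i u)) (≡.trans (cong length (column≡ i)) (length-padding (m i) (ws i)))
    width≡length : width ws ≡ length u
    width≡length = ≤-antisym
      (maxLen-least (λ i → length (ws i)) (λ i → subst (length (ws i) ≤_) (≡.sym (length-u i)) (m≤n+m _ (m i))))
      (valid⇒length≤width valid m ws column≡)
    column-pad≡ : ∀ i → column i (pad S ws) ≡ column i u
    column-pad≡ i = begin
      column i (pad S ws)                                              ≡⟨ column-pad ws i ⟩
      replicate (width ws ∸ length (ws i)) nothing ++ map just (ws i)  ≡⟨ cong (λ k → replicate k nothing ++ map just (ws i)) gap≡m ⟩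
      replicate (m i) nothing ++ map just (ws i)                       ≡⟨ column≡ i ⟨
      column i u                                                       ∎
      where
      open ≡-Reasoning
      gap≡m : width ws ∸ length (ws i) ≡ m i
      gap≡m = ≡.trans (cong (_∸ length (ws i)) (≡.trans width≡length (length-u i))) (m+n∸n≡m (m i) (length (ws i)))

  InL-prefix : (∀ i → PrefixClosed (S i)) → Fin d → ∀ {u} v → All (Valid S) u → InL S (u ++ v) → InL S u
  InL-prefix prefix-closed i₀ {u} v valid uv∈L = Accepted⇒InL i₀ valid λ i →
    CA.Accepts-prefix i (prefix-closed i) (column i u) (column i v)
      (subst (CA.Accepts i) (map-++ (λ a → a i) u v) (InL⇒Accepted uv∈L i))

  repS-zero : (∀ i → PrefixClosed (S i)) → repS S (λ _ → 0) ≡ []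
  repS-zero prefix-closed = pad-[] _ (λ i → rep-zero (S i) (prefix-closed i))

module Coefficients {c ℓ : Level} (K : Semiring c ℓ) {d} (S : Fin d → ANS) where
  open Semiring K hiding (zero)
  open LinearAlgebra K
  open BoldWords S

  IsCoeff-resp-≋ : ∀ {f u v x} → u ≋ v → IsCoeff K S f u x → IsCoeff K S f v x
  IsCoeff-resp-≋ u≋v (on-L , off-L) =
    (λ m rep≋v → on-L m (≋-trans rep≋v (≋-sym u≋v))) , (λ v∉L → off-L (λ u∈L → v∉L (InL-resp-≋ u∈L u≋v)))

  IsCoeff-resp-≈ : ∀ {f u x y} → x ≈ y → IsCoeff K S f u x → IsCoeff K S f u y
  IsCoeff-resp-≈ x≈y (on-L , off-L) = (λ m e → trans (sym x≈y) (on-L m e)) , (λ u∉L → trans (sym x≈y) (off-L u∉L))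

  IsCoeff-resp-seq : ∀ {f g u x} → (∀ n → f n ≈ g n) → IsCoeff K S f u x → IsCoeff K S g u x
  IsCoeff-resp-seq f≈g (on-L , off-L) = (λ m e → trans (on-L m e) (f≈g m)) , off-L

  IsCoeff-dot : ∀ {t u} (g : Fin t → Seq K d) (x y : Fin t → Carrier) →
                (∀ j → IsCoeff K S (g j) u (y j)) → IsCoeff K S (λ n → dot (λ j → g j n) x) u (dot y x)
  IsCoeff-dot g x y coeff =
    (λ m e → ∑-cong (λ j → *-congʳ (proj₁ (coeff j) m e))) ,
    (λ u∉L → ∑-zero (λ j → trans (*-congʳ (proj₂ (coeff j) u∉L)) (zeroˡ (x j))))

  vanishing-regular : ∀ {f} → (∀ n → f n ≈ 0#) → Regular K S f
  vanishing-regular f≈0 = 0 , (λ _ _ _ → 0#) , (λ _ → 0#) , (λ _ → 0#) , λ _ _ →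
    (λ m _ → trans vanishes (sym (f≈0 m))) , (λ _ → vanishes)
    where
    vanishes : ∀ {z} → 0# * z + 0# ≈ 0#
    vanishes = trans (+-identityʳ _) (zeroˡ _)

module StableToRegular {c ℓ : Level} (K : Semiring c ℓ) {d} (S : Fin d → ANS)
    (prefix-closed : ∀ i → PrefixClosed (S i)) (i₀ : Fin d)
    {t} (g : Fin t → Seq K d) (stable : Stable K S g) where
  open Semiring K hiding (zero)
  open LinearAlgebra K
  open BoldWords S
  open Coefficients K S

  combination : (Fin t → Carrier) → Seq K d
  combination x n = dot (λ j → g j n) x

  generator-in-span : ∀ j → InSpan K g (g j)
  generator-in-span j = (λ l → idMat K l j) , (λ n → sym (∑-idMatʳ j (λ l → g l n)))

  -- Obtained from stability under the empty word rather than from injectivity of repS S.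
  span-resp-repS : ∀ {h} → InSpan K g h → ∀ {m n} → repS S m ≋ repS S n → h m ≈ h n
  span-resp-repS h∈span {m} {n} rep≋ with stable _ h∈span [] []
  ... | _ , _ , h∘ε = trans (sym (proj₁ (h∘ε n) m (≋-trans rep≋ ε))) (proj₁ (h∘ε n) n ε)
    where
    ε : repS S n ≋ (repS S n ++ [])
    ε = ≋-reflexive (≡.sym (++-identityʳ (repS S n)))

  letterMatrix : Letter S → Mat K t
  letterMatrix a with Valid? a
  ... | yes valid = λ l j → proj₁ (proj₁ (proj₂ (stable (g j) (generator-in-span j) (a ∷ []) (valid ∷ [])))) l
  ... | no _ = λ _ _ → 0#   -- Regular only evaluates μ* on words of valid letters

  letterMatrix-column : ∀ a → Valid S a → ∀ j n →
                        IsCoeff K S (g j) (repS S n ++ a ∷ []) (dot (λ l → g l n) (λ l → letterMatrix a l j))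
  letterMatrix-column a valid j n with Valid? a
  ... | no invalid = ⊥-elim (invalid valid)
  ... | yes valid′ with stable (g j) (generator-in-span j) (a ∷ []) (valid′ ∷ [])
  ...   | _ , (_ , g∘a≈) , g∘a = IsCoeff-resp-≈ (g∘a≈ n) (g∘a n)

  combination-letter : ∀ a → Valid S a → ∀ y n →
    IsCoeff K S (combination y) (repS S n ++ a ∷ []) (combination (matVec (letterMatrix a) y) n)
  combination-letter a valid y n = IsCoeff-resp-≈ (sym (dot-matVec (λ l → g l n) (letterMatrix a) y))
    (IsCoeff-dot g y _ (λ j → letterMatrix-column a valid j n))

  combination-cons : ∀ a w x n → combination (matVec (μ* K letterMatrix (a ∷ w)) x) n ≈
                                 combination (matVec (letterMatrix a) (matVec (μ* K letterMatrix w) x)) n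
  combination-cons a w x n = dot-congʳ _ (matVec-mulMat (letterMatrix a) (μ* K letterMatrix w) x)

  combination-word : ∀ w → All (Valid S) w → ∀ x n →
    IsCoeff K S (combination x) (repS S n ++ w) (combination (matVec (μ* K letterMatrix w) x) n)
  combination-word [] [] x n =
    (λ m rep≋ → trans identity (sym (span-resp-repS (x , λ _ → refl) (≋-trans rep≋ (≋-reflexive (++-identityʳ _)))))) ,
    (λ n∉L → ⊥-elim (n∉L (InL-resp-≋ (repS∈L n) (≋-reflexive (≡.sym (++-identityʳ _))))))
    where
    identity : combination (matVec (idMat K) x) n ≈ combination x n
    identity = dot-congʳ _ (matVec-identity x)
  combination-word (a ∷ w) (valid ∷ valid-w) x n with Accepting? (states (repS S n ++ a ∷ []))
  ... | yes accepted = IsCoeff-resp-≋ rep-m++w≋ (IsCoeff-resp-≈ (sym value≈) (combination-word w valid-w x m))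
    where
    m∈L : ∃ λ m → repS S m ≋ (repS S n ++ a ∷ [])
    m∈L = InL⇒repS i₀ (Accepted⇒InL i₀ (++⁺ (repS-valid i₀ n) (valid ∷ [])) accepted)
    m : Fin d → ℕ
    m = proj₁ m∈L
    rep-m≋ : repS S m ≋ (repS S n ++ a ∷ [])
    rep-m≋ = proj₂ m∈L
    rep-m++w≋ : (repS S m ++ w) ≋ (repS S n ++ a ∷ w)
    rep-m++w≋ = ≋-trans (≋-++ rep-m≋ ≋-refl) (≋-reflexive (++-assoc (repS S n) (a ∷ []) w))
    value≈ : combination (matVec (μ* K letterMatrix (a ∷ w)) x) n ≈ combination (matVec (μ* K letterMatrix w) x) m
    value≈ = trans (combination-cons a w x n) (proj₁ (combination-letter a valid _ n) m rep-m≋)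
  ... | no rejected = (λ m rep≋ → ⊥-elim (rejected (prefix-accepted m rep≋))) ,
                      (λ _ → trans (combination-cons a w x n) (proj₂ (combination-letter a valid _ n) (rejected ∘ InL⇒Accepted)))
    where
    prefix-accepted : ∀ m → repS S m ≋ (repS S n ++ a ∷ w) → Accepted (repS S n ++ a ∷ [])
    prefix-accepted m rep≋ = InL⇒Accepted (InL-prefix prefix-closed i₀ w (++⁺ (repS-valid i₀ n) (valid ∷ []))
      (InL-resp-≋ (repS∈L m) (≋-trans rep≋ (≋-reflexive (≡.sym (++-assoc (repS S n) (a ∷ []) w))))))

stable⇒regular : ∀ {c ℓ} (K : Semiring c ℓ) {d} (S : Fin d → ANS) → (∀ i → PrefixClosed (S i)) → Fin d →
                 ∀ f → InStableFG K S f → Regular K S f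
stable⇒regular K S prefix-closed i₀ f (zero , g , stable , κ , f∈span) =
  Coefficients.vanishing-regular K S f∈span
stable⇒regular K S prefix-closed i₀ f (suc t , g , stable , κ , f∈span) =
  t , letterMatrix , (λ l → g l origin) , κ , λ w valid →
    IsCoeff-resp-seq (λ n → sym (f∈span n))
      (IsCoeff-resp-≋ (≋-reflexive (cong (_++ w) (repS-zero prefix-closed))) (combination-word w valid κ origin))
  where
  open Semiring K using (sym)
  open BoldWords S
  open Coefficients K S
  open StableToRegular K S prefix-closed i₀ g stable
  origin : Fin _ → ℕ
  origin _ = 0

module RegularToStable {c ℓ : Level} (K : Semiring c ℓ) {d} (S : Fin d → ANS) (i₀ : Fin d)
    {r} (μ : Letter S → Mat K r) (λv : Fin r → Semiring.Carrier K) where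
  open Semiring K hiding (zero)
  open LinearAlgebra K
  open BoldWords S
  open import Relation.Binary.Reasoning.Setoid setoid

  -- A letter is a function, on which μ need not be extensional; routing letters through
  -- first-order tuples makes μ̂ respect ≋.
  normalise : Letter S → Letter S
  normalise a = fromTuple (toTuple a)

  μ̂ : Letter S → Mat K r
  μ̂ = μ ∘ normalise

  μ̂*-resp-≋ : ∀ {u v} → u ≋ v → μ* K μ̂ u ≡ μ* K μ̂ v
  μ̂*-resp-≋ [] = ≡.refl
  μ̂*-resp-≋ (a≗b ∷ u≋v) = cong₂ (mulMat K) (cong (μ ∘ fromTuple) (toTuple-cong a≗b)) (μ̂*-resp-≋ u≋v)

  μ̂*≡μ*-normalise : ∀ u → μ* K μ̂ u ≡ μ* K μ (map normalise u)
  μ̂*≡μ*-normalise [] = ≡.refl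
  μ̂*≡μ*-normalise (a ∷ u) = cong (mulMat K (μ̂ a)) (μ̂*≡μ*-normalise u)

  ≋-normalise : ∀ u → u ≋ map normalise u
  ≋-normalise [] = []
  ≋-normalise (a ∷ u) = (λ i → ≡.sym (fromTuple-toTuple a i)) ∷ ≋-normalise u

  normalise-valid : ∀ {u} → All (Valid S) u → All (Valid S) (map normalise u)
  normalise-valid [] = []
  normalise-valid {a ∷ _} ((i , just-aᵢ) ∷ valid) =
    (i , subst Is-just (≡.sym (fromTuple-toTuple a i)) just-aᵢ) ∷ normalise-valid valid

  stateCount : Fin d → ℕ
  stateCount i = suc (suc (ANS.states (S i)))

  N : ℕ
  N = ∏ stateCount

  code : Word S → Fin N
  code u = encode (states u)

  decodeStates : Fin N → States
  decodeStates = decode {sz = stateCount}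

  row : Word S → Fin r → Carrier
  row u = vecMat λv (μ* K μ̂ u)

  row-++ : ∀ u w l → row (u ++ w) l ≈ vecMat (row u) (μ* K μ̂ w) l
  row-++ u w l = trans (dot-congʳ λv (λ i → μ*-++ μ̂ u w i l)) (dot-matVec λv (μ* K μ̂ u) (λ l′ → μ* K μ̂ w l′ l))

  index : Fin N → Fin r → Fin (N *ℕ r)
  index = combine

  unindex : Fin (N *ℕ r) → Fin N × Fin r
  unindex = remQuot {N} r

  unindex-index : ∀ c l → unindex (index c l) ≡ (c , l)
  unindex-index = remQuot-combine

  generator : Fin (N *ℕ r) → Seq K d
  generator e n = idMat K (code (repS S n)) (proj₁ (unindex e)) * row (repS S n) (proj₂ (unindex e))

  dot-generator : ∀ κ n → dot (λ e → generator e n) κ ≈ dot (row (repS S n)) (λ l → κ (index (code (repS S n)) l))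
  dot-generator κ n = begin
    ∑ (λ e → generator e n * κ e)                               ≈⟨ ∑-combine N (λ e → generator e n * κ e) ⟩
    ∑ (λ c → ∑ (λ l → generator (index c l) n * κ (index c l))) ≈⟨ ∑-cong {N} (λ c → ∑-cong {r} (λ l →
                                                                      *-congʳ (reflexive (generator-index c l)))) ⟩
    ∑ (λ c → ∑ (λ l → (idMat K x c * ρ l) * κ (index c l)))     ≈⟨ ∑-cong {N} pull-indicator ⟩
    ∑ (λ c → idMat K x c * ∑ (λ l → ρ l * κ (index c l)))       ≈⟨ ∑-idMatˡ x (λ c → ∑ (λ l → ρ l * κ (index c l))) ⟩
    ∑ (λ l → ρ l * κ (index x l))                               ∎
    where
    x : Fin N
    x = code (repS S n)
    ρ : Fin r → Carrier
    ρ = row (repS S n)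
    generator-index : ∀ c l → generator (index c l) n ≡ idMat K x c * ρ l
    generator-index c l = cong (λ p → idMat K x (proj₁ p) * ρ (proj₂ p)) (unindex-index c l)
    pull-indicator : ∀ c → ∑ (λ l → (idMat K x c * ρ l) * κ (index c l)) ≈ idMat K x c * ∑ (λ l → ρ l * κ (index c l))
    pull-indicator c = trans (∑-cong {r} (λ l → *-assoc (idMat K x c) (ρ l) (κ (index c l))))
                             (sym (*-distribˡ-∑ (idMat K x c) (λ l → ρ l * κ (index c l))))

  span-of-linear-representation : ∀ {f} (γ : Fin r → Carrier) →
    (∀ w → All (Valid S) w → IsCoeff K S f w (bilin K λv (μ* K μ w) γ)) → InSpan K generator f
  span-of-linear-representation {f} γ representation = (γ ∘ proj₂ ∘ unindex) , λ n → begin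
    f n                                               ≈⟨ sym (proj₁ (representation _ (normalise-valid (repS-valid i₀ n))) n
                                                                   (≋-normalise (repS S n))) ⟩
    bilin K λv (μ* K μ (map normalise (repS S n))) γ  ≡⟨ cong (λ M → bilin K λv M γ) (≡.sym (μ̂*≡μ*-normalise (repS S n))) ⟩
    dot λv (matVec (μ* K μ̂ (repS S n)) γ)             ≈⟨ dot-matVec λv (μ* K μ̂ (repS S n)) γ ⟩
    dot (row (repS S n)) γ                            ≈⟨ dot-congʳ (row (repS S n)) (λ l →
                                                           reflexive (cong (γ ∘ proj₂) (≡.sym (unindex-index _ l)))) ⟩
    dot (row (repS S n)) (λ l → γ (proj₂ (unindex (index (code (repS S n)) l))))
                                                      ≈⟨ dot-generator (γ ∘ proj₂ ∘ unindex) n ⟨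
    dot (λ e → generator e n) (γ ∘ proj₂ ∘ unindex)   ∎

  successor : Word S → States → States
  successor w s i = CA.run i (s i) (column i w)

  states-++ : ∀ u w i → states (u ++ w) i ≡ successor w (states u) i
  states-++ u w i = ≡.trans (cong (CA.run i waiting) (map-++ (λ a → a i) u w))
                            (foldl-++ (CA.step i) waiting (column i u) (column i w))

  successor-code : ∀ u w i → successor w (decodeStates (code u)) i ≡ states (u ++ w) i
  successor-code u w i = ≡.trans (cong (λ s → CA.run i s (column i w)) (decode-encode (states u) i))
                                 (≡.sym (states-++ u w i))

  shift : Word S → (Fin (N *ℕ r) → Carrier) → Fin N → Fin r → Carrier
  shift w κ c with Accepting? (successor w (decodeStates c))
  ... | yes _ = matVec (μ* K μ̂ w) (λ l → κ (index (encode (successor w (decodeStates c))) l))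
  ... | no _ = λ _ → 0#

  shift-accepting : ∀ w κ c → Accepting (successor w (decodeStates c)) → ∀ l →
    shift w κ c l ≈ matVec (μ* K μ̂ w) (λ l′ → κ (index (encode (successor w (decodeStates c))) l′)) l
  shift-accepting w κ c accepting l with Accepting? (successor w (decodeStates c))
  ... | yes _ = refl
  ... | no rejecting = ⊥-elim (rejecting accepting)

  shift-rejecting : ∀ w κ c → ¬ Accepting (successor w (decodeStates c)) → ∀ l → shift w κ c l ≈ 0#
  shift-rejecting w κ c rejecting l with Accepting? (successor w (decodeStates c))
  ... | yes accepting = ⊥-elim (rejecting accepting)
  ... | no _ = refl

  dot-shift : ∀ w κ n m → Accepting (successor w (decodeStates (code (repS S n)))) → repS S m ≋ (repS S n ++ w) →
              dot (row (repS S n)) (shift w κ (code (repS S n))) ≈ dot (λ e → generator e m) κ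
  dot-shift w κ n m accepting rep≋ = begin
    dot (row (repS S n)) (shift w κ x)                            ≈⟨ dot-congʳ (row (repS S n)) (shift-accepting w κ x accepting) ⟩
    dot (row (repS S n)) (matVec (μ* K μ̂ w) (λ l → κ (index y l))) ≈⟨ dot-matVec (row (repS S n)) (μ* K μ̂ w) _ ⟩
    dot (vecMat (row (repS S n)) (μ* K μ̂ w)) (λ l → κ (index y l)) ≈⟨ dot-congˡ _ (λ l → sym (row-++ (repS S n) w l)) ⟩
    dot (row (repS S n ++ w)) (λ l → κ (index y l))               ≡⟨ cong₂ (λ M c → dot (vecMat λv M) (λ l → κ (index c l)))
                                                                           (μ̂*-resp-≋ (≋-sym rep≋)) y≡code ⟩
    dot (row (repS S m)) (λ l → κ (index (code (repS S m)) l))    ≈⟨ dot-generator κ m ⟨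
    dot (λ e → generator e m) κ                                   ∎
    where
    x y : Fin N
    x = code (repS S n)
    y = encode (successor w (decodeStates x))
    y≡code : y ≡ code (repS S m)
    y≡code = encode-cong (λ i → ≡.trans (successor-code (repS S n) w i)
                                        (cong (CA.run i waiting) (column-≋ i (≋-sym rep≋))))

  generators-stable : Stable K S generator
  generators-stable h (κ , h≈) w valid-w = h′ , (κ′ , λ _ → refl) , h∘w
    where
    κ′ : Fin (N *ℕ r) → Carrier
    κ′ e = shift w κ (proj₁ (unindex e)) (proj₂ (unindex e))
    h′ : Seq K d
    h′ n = dot (λ e → generator e n) κ′
    h′≈ : ∀ n → h′ n ≈ dot (row (repS S n)) (shift w κ (code (repS S n)))
    h′≈ n = trans (dot-generator κ′ n)
      (dot-congʳ _ (λ l → reflexive (cong (λ p → shift w κ (proj₁ p) (proj₂ p)) (unindex-index _ l))))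
    h∘w : IsComp K S h w h′
    h∘w n with Accepting? (successor w (decodeStates (code (repS S n))))
    ... | yes accepting =
      (λ m rep≋ → trans (h′≈ n) (trans (dot-shift w κ n m accepting rep≋) (sym (h≈ m)))) ,
      (λ ∉L → ⊥-elim (∉L (Accepted⇒InL i₀ (++⁺ (repS-valid i₀ n) valid-w)
                                          (Accepting-resp (successor-code (repS S n) w) accepting))))
    ... | no rejecting =
      (λ m rep≋ → ⊥-elim (rejecting (Accepting-resp (≡.sym ∘ successor-code (repS S n) w)
                                                   (InL⇒Accepted (InL-resp-≋ (repS∈L m) rep≋))))) ,
      (λ _ → trans (h′≈ n) (∑-zero (λ l → trans (*-congˡ (shift-rejecting w κ _ rejecting l)) (zeroʳ _))))

regular⇒stable : ∀ {c ℓ} (K : Semiring c ℓ) {d} (S : Fin d → ANS) → Fin d →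
                 ∀ f → Regular K S f → InStableFG K S f
regular⇒stable K S i₀ f (r , μ , λv , γ , representation) =
  N *ℕ suc r , generator , generators-stable , span-of-linear-representation γ representation
  where open RegularToStable K S i₀ μ λv

theorem5p6 : ∀ {c ℓ : Level} (K : Semiring c ℓ) (d : ℕ) → 1 ≤ d →
    (S : Fin d → ANS) → (∀ i → PrefixClosed (S i)) →
    (f : Seq K d) → Regular K S f ⇔ InStableFG K S f
theorem5p6 K (suc d) (s≤s _) S prefix-closed f =
  mk⇔ (regular⇒stable K S zero f) (stable⇒regular K S prefix-closed zero f)
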